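{- Let $k\ge 2$ be an integer. If $G$ is a finite simple graph of order $n\ge 2k-2$ with maximum degree $\Delta(G)$ such that $k\ge \Delta(G)+1$, then $d_R^k(G)=2k-1$.
   Context: Let $k\ge1$ be an integer. A Roman $k$-dominating function (RkDF) on a graph $G$ is a map $f:V(G)\to\{0,1,2\}$ such that every vertex $v$ with $f(v)=0$ has at least $k$ neighbors $u$ with $f(u)=2$. A set $\{f_1,\ldots,f_d\}$ of pairwise distinct RkDFs on $G$ with $\sum_{i=1}^d f_i(v)\le 2k$ for every $v\in V(G)$ is a Roman $(k,k)$-dominating family on $G$; the maximum number of functions in such a family is the Roman $(k,k)$-domatic number $d_R^k(G)$. -}

module Defs where

open import Data.Nat using (ℕ; zero; suc; _+_; _*_; _∸_; _≤_; _⊔_; _≡ᵇ_)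
open import Data.Bool using (Bool; true; false; _∧_; if_then_else_)
open import Data.Fin using (Fin; zero; suc; toℕ)
open import Data.Product using (Σ; _×_)
open import Relation.Binary.PropositionalEquality using (_≡_; _≢_)
open import Relation.Nullary using (¬_)

record Graph (n : ℕ) : Set where
  field
    adj   : Fin n → Fin n → Bool
    sym   : ∀ u v → adj u v ≡ adj v u
    loopless : ∀ v → adj v v ≡ false
open Graph public

sumFin : ∀ {n} → (Fin n → ℕ) → ℕ
sumFin {zero}  f = 0
sumFin {suc n} f = f zero + sumFin (λ i → f (suc i))

maxFin : ∀ {n} → (Fin n → ℕ) → ℕ
maxFin {zero}  f = 0
maxFin {suc n} f = f zero ⊔ maxFin (λ i → f (suc i))

indicator : Bool → ℕ
indicator true  = 1
indicator false = 0

degree : ∀ {n} → Graph n → Fin n → ℕ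
degree G v = sumFin (λ u → indicator (adj G v u))

maxDegree : ∀ {n} → Graph n → ℕ
maxDegree G = maxFin (degree G)

RFun : ℕ → Set
RFun n = Fin n → Fin 3

twoNeighbours : ∀ {n} → Graph n → RFun n → Fin n → ℕ
twoNeighbours G f v = sumFin (λ u → indicator (adj G v u ∧ (toℕ (f u) ≡ᵇ 2)))

IsRkDF : ∀ {n} → Graph n → ℕ → RFun n → Set
IsRkDF G k f = ∀ v → toℕ (f v) ≡ 0 → k ≤ twoNeighbours G f v

IsRkkFamily : ∀ {n} → Graph n → ℕ → (d : ℕ) → (Fin d → RFun n) → Set
IsRkkFamily {n} G k d F =
  (∀ i → IsRkDF G k (F i)) ×
  (∀ i j → i ≢ j → ¬ (∀ v → F i v ≡ F j v)) ×
  (∀ v → sumFin (λ i → toℕ (F i v)) ≤ 2 * k)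

IsRkkDomaticNumber : ∀ {n} → Graph n → ℕ → ℕ → Set
IsRkkDomaticNumber {n} G k m =
  Σ (Fin m → RFun n) (λ F → IsRkkFamily G k m F) ×
  (∀ d (F : Fin d → RFun n) → IsRkkFamily G k d F → d ≤ m)

module Submission where

-- No vertex has k neighbours at all, so a Roman k-dominating
-- function can never assign 0: every RkDF is everywhere positive.  If a
-- Roman (k,k)-dominating family had d ≥ 2k members, then at each vertex the
-- d positive values would sum to at most 2k ≤ d, forcing every value to be 1;
-- all members would be the constant function 1, which contradicts pairwise
-- distinctness because d ≥ 2.  Hence d < 2k, i.e. d ≤ 2k - 1.
--
-- For M ≤ n the "standard family" consists of the constant
-- function 1 together with, for each i < M, the function that is 2 at the
-- vertex i and 1 elsewhere.  Its M + 1 members are positive (hence RkDFs in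
-- any graph) and pairwise distinct, and each vertex carries total weight at
-- most M + 2.  With M = 2k - 2 this is a family of 2k - 1 functions.

open import Defs
open import Data.Nat using (ℕ; zero; suc; _+_; _*_; _∸_; _≤_; _<_; z≤n; s≤s; _≡ᵇ_; _≤?_)
open import Data.Nat.Properties
open import Algebra.Properties.CommutativeSemigroup +-commutativeSemigroup using (x∙yz≈y∙xz)
open import Data.Bool using (Bool; true; false; _∧_; T)
open import Data.Fin using (Fin; zero; suc; toℕ; inject≤)
open import Data.Fin.Properties using (toℕ-injective; toℕ-inject≤)
open import Data.Product using (_,_)
open import Function using (_∘_)
open import Relation.Nullary using (¬_; yes; no; contradiction)
open import Relation.Binary.PropositionalEquality using (_≡_; _≢_; refl; cong; trans; subst)
open import Relation.Binary.PropositionalEquality using () renaming (sym to ≡-sym)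

sumFin-mono : ∀ {m} (f g : Fin m → ℕ) → (∀ i → f i ≤ g i) → sumFin f ≤ sumFin g
sumFin-mono {zero}  f g f≤g = z≤n
sumFin-mono {suc m} f g f≤g =
  +-mono-≤ (f≤g zero) (sumFin-mono (λ i → f (suc i)) (λ i → g (suc i)) (λ i → f≤g (suc i)))

sumFin-cong : ∀ {m} {f g : Fin m → ℕ} → (∀ i → f i ≡ g i) → sumFin f ≡ sumFin g
sumFin-cong f≡g = ≤-antisym (sumFin-mono _ _ (≤-reflexive ∘ f≡g)) (sumFin-mono _ _ (≤-reflexive ∘ ≡-sym ∘ f≡g))

sumFin-zero : ∀ m → sumFin {m} (λ _ → 0) ≡ 0
sumFin-zero zero    = refl
sumFin-zero (suc m) = sumFin-zero m

sumFin-suc : ∀ {m} (h : Fin m → ℕ) → sumFin (λ i → suc (h i)) ≡ m + sumFin h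
sumFin-suc {zero}  h = refl
sumFin-suc {suc m} h = cong suc (trans (cong (h zero +_) (sumFin-suc (λ i → h (suc i))))
                                       (x∙yz≈y∙xz (h zero) m _))

size≤sumFin : ∀ {m} (g : Fin m → ℕ) → (∀ i → 1 ≤ g i) → m ≤ sumFin g
size≤sumFin {zero}  g pos = z≤n
size≤sumFin {suc m} g pos = +-mono-≤ (pos zero) (size≤sumFin (λ i → g (suc i)) (λ i → pos (suc i)))

sumFin≤size⇒all-one : ∀ {m} (g : Fin m → ℕ) → (∀ i → 1 ≤ g i) → sumFin g ≤ m → ∀ i → g i ≡ 1
sumFin≤size⇒all-one {suc m} g pos bound zero =
  ≤-antisym (+-cancelʳ-≤ m (g zero) 1 (≤-trans (+-monoʳ-≤ (g zero) m≤tail) bound)) (pos zero)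
  where
  m≤tail : m ≤ sumFin (λ i → g (suc i))
  m≤tail = size≤sumFin (λ i → g (suc i)) (λ i → pos (suc i))
sumFin≤size⇒all-one {suc m} g pos bound (suc i) =
  sumFin≤size⇒all-one (λ j → g (suc j)) (λ j → pos (suc j))
                      (+-cancelˡ-≤ 1 _ _ (≤-trans (+-monoˡ-≤ _ (pos zero)) bound)) i

twoNeighbours≤degree : ∀ {n} (G : Graph n) (f : RFun n) v → twoNeighbours G f v ≤ degree G v
twoNeighbours≤degree G f v = sumFin-mono _ _ (λ u → indicator-∧ (adj G v u) _)
  where
  indicator-∧ : ∀ a b → indicator (a ∧ b) ≤ indicator a
  indicator-∧ true  true  = ≤-refl
  indicator-∧ true  false = z≤n
  indicator-∧ false b     = z≤n

≤maxFin : ∀ {m} (f : Fin m → ℕ) (v : Fin m) → f v ≤ maxFin f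
≤maxFin f zero    = m≤m⊔n _ _
≤maxFin f (suc v) = ≤-trans (≤maxFin (λ i → f (suc i)) v) (m≤n⊔m (f zero) _)

-- When Δ(G) < k, no vertex has k neighbours, so an RkDF never takes the value 0.
RkDF-positive : ∀ {n} (G : Graph n) {k} → maxDegree G < k →
  (f : RFun n) → IsRkDF G k f → ∀ v → 0 < toℕ (f v)
RkDF-positive G Δ<k f isRkDF v = n≢0⇒n>0 λ fv≡0 →
  <⇒≱ Δ<k (≤-trans (isRkDF v fv≡0) (≤-trans (twoNeighbours≤degree G f v) (≤maxFin (degree G) v)))

agreeing-family-size : ∀ {n d} (F : Fin d → RFun n) →
  (∀ i j → i ≢ j → ¬ (∀ v → F i v ≡ F j v)) → (∀ i j v → F i v ≡ F j v) → d ≤ 1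
agreeing-family-size {d = zero}        F distinct agree = z≤n
agreeing-family-size {d = suc zero}    F distinct agree = ≤-refl
agreeing-family-size {d = suc (suc d)} F distinct agree =
  contradiction (agree zero (suc zero)) (distinct zero (suc zero) λ ())

tight-positive-family : ∀ {n d} (F : Fin d → RFun n) → (∀ i v → 0 < toℕ (F i v)) →
  (∀ v → sumFin (λ i → toℕ (F i v)) ≤ d) → ∀ i v → toℕ (F i v) ≡ 1
tight-positive-family F pos bound i v = sumFin≤size⇒all-one (λ j → toℕ (F j v)) (λ j → pos j v) (bound v) i

RkkFamily-size : ∀ {n} (G : Graph n) {k} → maxDegree G < k →
  ∀ {d} (F : Fin d → RFun n) → IsRkkFamily G k d F → d < 2 * k
RkkFamily-size G {k} Δ<k {d} F (isRkDF , distinct , load) with 2 * k ≤? d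
... | no  2k≰d = ≰⇒> 2k≰d
... | yes 2k≤d = contradiction (≤-trans 2≤2k (≤-trans 2k≤d d≤1)) λ { (s≤s ()) }
  where
  2≤2k : 2 ≤ 2 * k
  2≤2k = *-monoʳ-≤ 2 (≤-trans (s≤s z≤n) Δ<k)
  positive : ∀ i v → 0 < toℕ (F i v)
  positive i = RkDF-positive G Δ<k (F i) (isRkDF i)
  all-one : ∀ i v → toℕ (F i v) ≡ 1
  all-one = tight-positive-family F positive (λ v → ≤-trans (load v) 2k≤d)
  d≤1 : d ≤ 1
  d≤1 = agreeing-family-size F distinct λ i j v → toℕ-injective (trans (all-one i v) (≡-sym (all-one j v)))

positive⇒RkDF : ∀ {n} (G : Graph n) k (f : RFun n) → (∀ v → 0 < toℕ (f v)) → IsRkDF G k f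
positive⇒RkDF G k f pos v fv≡0 = contradiction fv≡0 (m<n⇒n≢0 (pos v))

one two : Fin 3
one = suc zero
two = suc (suc zero)

oneOrTwo : Bool → Fin 3
oneOrTwo false = one
oneOrTwo true  = two

toℕ-oneOrTwo : ∀ b → toℕ (oneOrTwo b) ≡ suc (indicator b)
toℕ-oneOrTwo false = refl
toℕ-oneOrTwo true  = refl

T⇒oneOrTwo≡two : ∀ {b} → T b → oneOrTwo b ≡ two
T⇒oneOrTwo≡two {true} _ = refl

oneOrTwo≡two⇒T : ∀ b → oneOrTwo b ≡ two → T b
oneOrTwo≡two⇒T true _ = _

standardFamily : ∀ {n} M → Fin (suc M) → RFun n
standardFamily M zero    v = one
standardFamily M (suc i) v = oneOrTwo (toℕ i ≡ᵇ toℕ v)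

standardFamily-positive : ∀ {n} M i (v : Fin n) → 0 < toℕ (standardFamily M i v)
standardFamily-positive M zero    v = s≤s z≤n
standardFamily-positive M (suc i) v = subst (0 <_) (≡-sym (toℕ-oneOrTwo (toℕ i ≡ᵇ toℕ v))) (s≤s z≤n)

standardFamily-marked : ∀ {n M} (M≤n : M ≤ n) (i : Fin M) →
  standardFamily M (suc i) (inject≤ i M≤n) ≡ two
standardFamily-marked M≤n i = T⇒oneOrTwo≡two (≡⇒≡ᵇ (toℕ i) _ (≡-sym (toℕ-inject≤ i M≤n)))

standardFamily-only-marked : ∀ {n M} (j : Fin M) (v : Fin n) →
  standardFamily M (suc j) v ≡ two → toℕ j ≡ toℕ v
standardFamily-only-marked j v eq = ≡ᵇ⇒≡ (toℕ j) (toℕ v) (oneOrTwo≡two⇒T _ eq)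

-- Distinct members differ at the vertex marked by one of them.
standardFamily-distinct : ∀ {n M} → M ≤ n → ∀ i j → i ≢ j →
  ¬ (∀ (v : Fin n) → standardFamily M i v ≡ standardFamily M j v)
standardFamily-distinct M≤n zero zero i≢j agree = i≢j refl
standardFamily-distinct M≤n zero (suc j) i≢j agree
  with () ← trans (agree (inject≤ j M≤n)) (standardFamily-marked M≤n j)
standardFamily-distinct M≤n (suc i) zero i≢j agree
  with () ← trans (≡-sym (agree (inject≤ i M≤n))) (standardFamily-marked M≤n i)
standardFamily-distinct M≤n (suc i) (suc j) i≢j agree = i≢j (cong suc (≡-sym j≡i))
  where
  ι = inject≤ i M≤n
  j≡i : j ≡ i
  j≡i = toℕ-injective (trans (standardFamily-only-marked j ι
                                (trans (≡-sym (agree ι)) (standardFamily-marked M≤n i)))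
                              (toℕ-inject≤ i M≤n))

indexHits≤1 : ∀ m a → sumFin {m} (λ i → indicator (toℕ i ≡ᵇ a)) ≤ 1
indexHits≤1 zero    a       = z≤n
indexHits≤1 (suc m) zero    = s≤s (≤-reflexive (sumFin-zero m))
indexHits≤1 (suc m) (suc a) = indexHits≤1 m a

standardFamily-load : ∀ {n} M (v : Fin n) → sumFin (λ i → toℕ (standardFamily M i v)) ≤ M + 2
standardFamily-load M v = begin
  1 + sumFin (λ i → toℕ (oneOrTwo (marks i)))  ≡⟨ cong (1 +_) (sumFin-cong (λ i → toℕ-oneOrTwo (marks i))) ⟩
  1 + sumFin (λ i → suc (indicator (marks i))) ≡⟨ cong (1 +_) (sumFin-suc (λ i → indicator (marks i))) ⟩
  1 + (M + sumFin (λ i → indicator (marks i))) ≤⟨ +-monoʳ-≤ 1 (+-monoʳ-≤ M (indexHits≤1 M (toℕ v))) ⟩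
  1 + (M + 1)                                  ≡⟨ ≡-sym (+-suc M 1) ⟩
  M + 2                                        ∎
  where
  open ≤-Reasoning
  marks : Fin M → Bool
  marks i = toℕ i ≡ᵇ toℕ v

standardFamily-isRkkFamily : ∀ {n M} (G : Graph n) k → M ≤ n → M + 2 ≤ 2 * k →
  IsRkkFamily G k (suc M) (standardFamily M)
standardFamily-isRkkFamily {M = M} G k M≤n M+2≤2k =
  (λ i → positive⇒RkDF G k _ (standardFamily-positive M i)) ,
  standardFamily-distinct M≤n ,
  (λ v → ≤-trans (standardFamily-load M v) M+2≤2k)

corollary1 : (k n : ℕ) → 2 ≤ k → (G : Graph n) → 2 * k ∸ 2 ≤ n →
    maxDegree G + 1 ≤ k → IsRkkDomaticNumber G k (2 * k ∸ 1)
corollary1 k n (s≤s (s≤s _)) G 2k-2≤n Δ+1≤k =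
  (standardFamily (2 * k ∸ 2) , standardFamily-isRkkFamily G k 2k-2≤n load≤2k) ,
  λ d F isFamily → suc[m]≤n⇒m≤pred[n] (RkkFamily-size G Δ<k F isFamily)
  where
  -- Since k ≥ 2, the numbers 2k - 1 and pred (2k) and (2k - 2) + 1 coincide by computation.
  load≤2k : 2 * k ∸ 2 + 2 ≤ 2 * k
  load≤2k = ≤-reflexive (m∸n+n≡m (s≤s (s≤s z≤n)))
  Δ<k : maxDegree G < k
  Δ<k = subst (_≤ k) (+-comm (maxDegree G) 1) Δ+1≤k
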